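{- For every $n\ge 6$ and every word $w$ of length $n$ over an alphabet $\Sigma$, $SP_{n-2}(w)\le\lceil n/2\rceil$.
   Context: A scattered subword of $w$ is a (not necessarily contiguous) subsequence of $w$. A palindrome is a word equal to its reversal. For $t\ge 1$, $SP_t(w)$ is the number of distinct palindromes of length $t$ that are scattered subwords of $w$. -}

module Defs where

open import Data.Nat using (ℕ; _≡ᵇ_)
open import Data.List using (List; []; _∷_; _++_; map; filter; length; reverse; deduplicate)
open import Data.List.Properties using (≡-dec)
open import Relation.Binary.Definitions using (DecidableEquality)
open import Relation.Binary.PropositionalEquality using (_≡_)
open import Relation.Nullary.Decidable using (_×-dec_)
open import Data.Nat.Properties using (_≟_)

subwords : {A : Set} → List A → List (List A)
subwords []       = [] ∷ []
subwords (x ∷ xs) = map (x ∷_) (subwords xs) ++ subwords xs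

IsPalindrome : {A : Set} → List A → Set
IsPalindrome u = u ≡ reverse u

SP : {A : Set} → DecidableEquality A → ℕ → List A → ℕ
SP _≟A_ t w =
  length (deduplicate (≡-dec _≟A_)
    (filter (λ u → (length u ≟ t) ×-dec ≡-dec _≟A_ u (reverse u)) (subwords w)))

-- Write w = a v b.  A palindromic subword of length |w| - 2 has the form c u c with u a
-- palindrome; if c = a then u embeds in v, and otherwise the whole word embeds in v, so it is v.
-- Hence for a = b the count for w exceeds the count for v by at most one.  For a ≠ b the
-- palindrome cannot use both end letters, so it is a subword of length |w| - 2 of a v or of v b.
-- A word has at most two palindromic subwords one letter shorter than itself, and at most one
-- when its length is odd, because a v and v b are not both palindromes when |v| is odd.
-- For even n this recursion yields ⌈n/2⌉; for odd n the case a ≠ b costs 4 ≤ ⌈n/2⌉, and the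
-- case a = b uses the sharper bound ⌈n/2⌉ - 1 available when v is itself a palindrome.
module Submission where

open import Defs
open import Data.Nat using (ℕ; zero; suc; _+_; _*_; _≤_; _<_; _∸_; _⊔_; ⌈_/2⌉; z≤n; s≤s)
open import Data.Nat.Properties
  using (suc-injective; ≤-refl; ≤-reflexive; ≤-trans; <⇒≱; +-comm; +-identityʳ; +-mono-≤; n≤1+n;
         m≤m+n; m≤m⊔n; m≤n⊔m; ⊔-monoʳ-≤; m≤n⇒m⊔n≡n; m≤n⇒∃[o]m+o≡n; module ≤-Reasoning)
  renaming (_≟_ to _≟ℕ_)
open import Data.List
  using (List; []; _∷_; _++_; [_]; length; map; filter; reverse; deduplicate; initLast; _∷ʳ′_)
open import Data.List.Properties
  using (≡-dec; length-++; length-map; length-removeAt′; reverse-++; unfold-reverse;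
         ∷-injectiveˡ; ∷-injectiveʳ; ∷ʳ-injectiveˡ)
open import Data.List.Membership.Propositional using (_∈_)
open import Data.List.Membership.Propositional.Properties
  using (∈-map⁺; ∈-map⁻; ∈-++⁺ˡ; ∈-++⁺ʳ; ∈-++⁻; ∈-filter⁻; ∈-deduplicate⁻)
open import Data.List.Relation.Unary.Any using (here; there; index; _─_)
import Data.List.Relation.Unary.All as All
open import Data.List.Relation.Unary.AllPairs using (_∷_)
open import Data.List.Relation.Unary.Unique.Propositional using (Unique)
open import Data.List.Relation.Unary.Unique.DecPropositional.Properties using (deduplicate-!)
open import Data.List.Relation.Binary.Sublist.Propositional using (_⊆_; []; _∷_; _∷ʳ_; to∈)
open import Data.List.Relation.Binary.Sublist.Propositional.Properties
  using (∷⁻; ∷ʳ⁻; reverse⁺; reverse⁻; length-mono-≤; to-≋; []⊆-universal)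
open import Data.List.Relation.Binary.Equality.Propositional using (≋⇒≡)
open import Data.Product using (Σ-syntax; ∃-syntax; _×_; _,_; proj₁)
open import Data.Sum using (_⊎_; inj₁; inj₂)
open import Data.Empty using (⊥-elim)
open import Function using (_∘_)
open import Relation.Nullary using (¬_; Dec; yes; no)
open import Relation.Nullary.Decidable using (_×-dec_)
open import Relation.Binary.Definitions using (DecidableEquality)
open import Relation.Binary.PropositionalEquality
  using (_≡_; _≢_; refl; sym; trans; cong; subst; subst₂; module ≡-Reasoning)

length-++≤ : ∀ {A : Set} {m₁ m₂} (xs : List A) {ys} → length xs ≤ m₁ → length ys ≤ m₂ →
             length (xs ++ ys) ≤ m₁ + m₂
length-++≤ xs |xs|≤ |ys|≤ = subst (_≤ _) (sym (length-++ xs)) (+-mono-≤ |xs|≤ |ys|≤)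

module _ {A : Set} where

  ∈-─ : ∀ {x z : A} {ys} (x∈ys : x ∈ ys) → z ∈ ys → z ≢ x → z ∈ (ys ─ x∈ys)
  ∈-─ (here refl) (here refl) z≢x = ⊥-elim (z≢x refl)
  ∈-─ (here _)    (there z∈)  _   = z∈
  ∈-─ (there _)   (here refl) _   = here refl
  ∈-─ (there x∈)  (there z∈)  z≢x = there (∈-─ x∈ z∈ z≢x)

  Unique-⊆⇒length≤ : ∀ {xs ys : List A} → Unique xs → (∀ {z} → z ∈ xs → z ∈ ys) →
                      length xs ≤ length ys
  Unique-⊆⇒length≤ {[]}     _            _      = z≤n
  Unique-⊆⇒length≤ {x ∷ xs} {ys} (x∉xs ∷ !xs) xs⊆ys = begin
    suc (length xs)            ≤⟨ s≤s (Unique-⊆⇒length≤ !xs xs⊆ys─x) ⟩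
    suc (length (ys ─ x∈ys))   ≡⟨ sym (length-removeAt′ ys (index x∈ys)) ⟩
    length ys                  ∎
    where
    open ≤-Reasoning
    x∈ys = xs⊆ys (here refl)
    xs⊆ys─x : ∀ {z} → z ∈ xs → z ∈ (ys ─ x∈ys)
    xs⊆ys─x z∈xs = ∈-─ x∈ys (xs⊆ys (there z∈xs)) λ z≡x → All.lookup x∉xs z∈xs (sym z≡x)

  length-snoc : ∀ (v : List A) b → length (v ++ [ b ]) ≡ suc (length v)
  length-snoc v b = trans (length-++ v) (+-comm (length v) 1)

  length-snoc≡ : ∀ (v : List A) {n} b → length v ≡ n → length (v ++ [ b ]) ≡ suc n
  length-snoc≡ v b |v|≡n = trans (length-snoc v b) (cong suc |v|≡n)

  data Ends (n : ℕ) : List A → Set where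
    ends : ∀ a {v} b → length v ≡ n → Ends n (a ∷ v ++ [ b ])

  ends-view : ∀ {n} (w : List A) → length w ≡ 2 + n → Ends n w
  ends-view (a ∷ w) |w|≡ with initLast w
  ... | v ∷ʳ′ b = ends a b (suc-injective (trans (sym (length-snoc v b)) (suc-injective |w|≡)))
  ends-view (a ∷ .[]) () | []

  subwords-⊆ : ∀ (w : List A) {u} → u ∈ subwords w → u ⊆ w
  subwords-⊆ []      (here refl) = []
  subwords-⊆ (x ∷ w) u∈ with ∈-++⁻ (map (x ∷_) (subwords w)) u∈
  ... | inj₂ u∈′ = x ∷ʳ subwords-⊆ w u∈′
  ... | inj₁ xu∈ with _ , u∈′ , refl ← ∈-map⁻ (x ∷_) xu∈ = refl ∷ subwords-⊆ w u∈′

  ⊆-length⇒≡ : ∀ {p w : List A} → p ⊆ w → length p ≡ length w → p ≡ w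
  ⊆-length⇒≡ p⊆w |p|≡|w| = ≋⇒≡ (to-≋ |p|≡|w| p⊆w)

  reverse-snoc⁺ : ∀ {c a : A} {p w} → p ++ [ c ] ⊆ w ++ [ a ] → c ∷ reverse p ⊆ a ∷ reverse w
  reverse-snoc⁺ {c} {a} {p} {w} s =
    subst₂ _⊆_ (reverse-++ p [ c ]) (reverse-++ w [ a ]) (reverse⁺ s)

  snoc⁻ : ∀ {a : A} {p w} → p ++ [ a ] ⊆ w ++ [ a ] → p ⊆ w
  snoc⁻ s = reverse⁻ (∷⁻ (reverse-snoc⁺ s))

  snoc-≢⁻ : ∀ {c a : A} {p w} → c ≢ a → p ++ [ c ] ⊆ w ++ [ a ] → p ++ [ c ] ⊆ w
  snoc-≢⁻ {c} {p = p} {w} c≢a s =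
    reverse⁻ (subst (_⊆ reverse w) (sym (reverse-++ p [ c ])) (∷ʳ⁻ c≢a (reverse-snoc⁺ s)))

  palindrome-ends : ∀ {a b : A} {q} → IsPalindrome (a ∷ q ++ [ b ]) → a ≡ b × IsPalindrome q
  palindrome-ends {a} {b} {q} pal =
    ∷-injectiveˡ symmetric , ∷ʳ-injectiveˡ q (reverse q) (∷-injectiveʳ symmetric)
    where
    open ≡-Reasoning
    symmetric : a ∷ q ++ [ b ] ≡ b ∷ reverse q ++ [ a ]
    symmetric = begin
      a ∷ q ++ [ b ]                  ≡⟨ pal ⟩
      reverse (a ∷ q ++ [ b ])        ≡⟨ unfold-reverse a (q ++ [ b ]) ⟩
      reverse (q ++ [ b ]) ++ [ a ]   ≡⟨ cong (_++ [ a ]) (reverse-++ q [ b ]) ⟩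
      b ∷ reverse q ++ [ a ]          ∎

  palindrome-snoc : ∀ {c : A} {r} → IsPalindrome (c ∷ r) → c ∷ r ≡ reverse r ++ [ c ]
  palindrome-snoc {c} {r} pal = trans pal (unfold-reverse c r)

  -- a v b is then 2-periodic, and its length is odd.
  palindromic-shift⇒≡ : ∀ k {a b : A} {v} → length v ≡ suc (k * 2) →
                       IsPalindrome (a ∷ v) → IsPalindrome (v ++ [ b ]) → a ≡ b
  palindromic-shift⇒≡ zero {v = c ∷ []} _ pal-av pal-vb =
    trans (palindrome-ends {q = []} pal-av .proj₁) (palindrome-ends {q = []} pal-vb .proj₁)
  palindromic-shift⇒≡ (suc k) {v = v} |v|≡ pal-av pal-vb with ends-view v |v|≡
  ... | ends c {z} d |z|≡
      with a≡d , pal-cz ← palindrome-ends {q = c ∷ z} pal-av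
         | c≡b , pal-zd ← palindrome-ends {q = z ++ [ d ]} pal-vb =
    trans a≡d (trans (sym (palindromic-shift⇒≡ k |z|≡ pal-cz pal-zd)) c≡b)

  wrap : A → List A → List A
  wrap a v = a ∷ v ++ [ a ]

  Covers : ℕ → List A → List (List A) → Set
  Covers t w L = ∀ {p} → p ⊆ w → length p ≡ t → IsPalindrome p → p ∈ L

  SP≤ : ℕ → List A → ℕ → Set
  SP≤ t w m = Σ[ L ∈ List (List A) ] Covers t w L × length L ≤ m

  SP≤-mono : ∀ {t w m m′} → m ≤ m′ → SP≤ t w m → SP≤ t w m′
  SP≤-mono m≤m′ (L , cover , |L|≤m) = L , cover , ≤-trans |L|≤m m≤m′

  SP≤-empty : ∀ {w} → SP≤ 0 w 1
  SP≤-empty = [ [] ] , cover , ≤-refl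
    where
    cover : Covers 0 _ [ [] ]
    cover {[]} _ _ _ = here refl

  SP≤-singletons : ∀ {w} → SP≤ 1 w (length w)
  SP≤-singletons {w} = map [_] w , cover , ≤-reflexive (length-map [_] w)
    where
    cover : Covers 1 w (map [_] w)
    cover {_ ∷ []} c⊆w _ _ = ∈-map⁺ [_] (to∈ c⊆w)

  SP≤-too-long : ∀ {t w} → length w < t → SP≤ t w 0
  SP≤-too-long {w = w} |w|<t = [] , cover , z≤n
    where
    cover : Covers _ w []
    cover p⊆w |p|≡t _ = ⊥-elim (<⇒≱ |w|<t (subst (_≤ _) |p|≡t (length-mono-≤ p⊆w)))

  SP≤-whole : ∀ {t w} → length w ≡ t → SP≤ t w 1
  SP≤-whole {w = w} |w|≡t = [ w ] , cover , ≤-refl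
    where
    cover : Covers _ w [ w ]
    cover p⊆w |p|≡t _ = here (⊆-length⇒≡ p⊆w (trans |p|≡t (sym |w|≡t)))

  SP≤-whole-¬palindrome : ∀ {t w} → ¬ IsPalindrome w → length w ≡ t → SP≤ t w 0
  SP≤-whole-¬palindrome {w = w} ¬pal |w|≡t = [] , cover , z≤n
    where
    cover : Covers _ w []
    cover p⊆w |p|≡t pal
      with refl ← ⊆-length⇒≡ p⊆w (trans |p|≡t (sym |w|≡t)) = ⊥-elim (¬pal pal)

module Counting {A : Set} (_≟_ : DecidableEquality A) where

  wrap-⊆-wrap⁻ : ∀ {c a : A} {q v} → wrap c q ⊆ wrap a v → (c ≡ a × q ⊆ v) ⊎ wrap c q ⊆ v
  wrap-⊆-wrap⁻ {c} {a} s with c ≟ a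
  ... | yes refl = inj₁ (refl , snoc⁻ (∷⁻ s))
  ... | no c≢a   = inj₂ (snoc-≢⁻ {p = c ∷ _} c≢a (∷ʳ⁻ c≢a s))

  palindrome-⊆-ends-≢ : ∀ {a b : A} {p v} → a ≢ b → IsPalindrome p → p ⊆ a ∷ v ++ [ b ] →
                        p ⊆ v ++ [ b ] ⊎ p ⊆ a ∷ v
  palindrome-⊆-ends-≢ {p = []} _ _ _ = inj₁ ([]⊆-universal _)
  palindrome-⊆-ends-≢ {a} {b} {c ∷ r} {v} a≢b pal s with c ≟ a
  ... | no c≢a   = inj₁ (∷ʳ⁻ c≢a s)
  ... | yes refl = inj₂ (subst (_⊆ a ∷ v) (sym ends-with-a)
                        (snoc-≢⁻ {p = reverse r} {a ∷ v} a≢b p⊆w))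
    where
    ends-with-a = palindrome-snoc pal
    p⊆w = subst (_⊆ a ∷ v ++ [ b ]) ends-with-a s

  SP≤-ends-≢ : ∀ {t a b v m₁ m₂} → a ≢ b → SP≤ t (v ++ [ b ]) m₁ → SP≤ t (a ∷ v) m₂ →
               SP≤ t (a ∷ v ++ [ b ]) (m₁ + m₂)
  SP≤-ends-≢ a≢b (L₁ , cover₁ , |L₁|≤) (L₂ , cover₂ , |L₂|≤) =
    L₁ ++ L₂ , cover , length-++≤ L₁ |L₁|≤ |L₂|≤
    where
    cover : Covers _ _ (L₁ ++ L₂)
    cover p⊆w |p|≡t pal with palindrome-⊆-ends-≢ a≢b pal p⊆w
    ... | inj₁ p⊆vb = ∈-++⁺ˡ (cover₁ p⊆vb |p|≡t pal)
    ... | inj₂ p⊆av = ∈-++⁺ʳ L₁ (cover₂ p⊆av |p|≡t pal)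

  SP≤-wrap : ∀ {t a v m₁ m₂} → SP≤ t v m₁ → SP≤ (2 + t) v m₂ → SP≤ (2 + t) (wrap a v) (m₁ + m₂)
  SP≤-wrap {a = a} (L₁ , cover₁ , |L₁|≤) (L₂ , cover₂ , |L₂|≤) =
    map (wrap a) L₁ ++ L₂ , cover , length-++≤ (map (wrap a) L₁) |map-L₁|≤ |L₂|≤
    where
    |map-L₁|≤ = subst (_≤ _) (sym (length-map (wrap a) L₁)) |L₁|≤
    cover : Covers _ _ (map (wrap a) L₁ ++ L₂)
    cover {p} p⊆w |p|≡ pal with ends-view p |p|≡
    ... | ends c d |q|≡t with refl , palq ← palindrome-ends pal with wrap-⊆-wrap⁻ p⊆w
    ...   | inj₁ (refl , q⊆v) = ∈-++⁺ˡ (∈-map⁺ (wrap a) (cover₁ q⊆v |q|≡t palq))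
    ...   | inj₂ p⊆v          = ∈-++⁺ʳ _ (cover₂ p⊆v |p|≡ pal)

  palindrome? : (u : List A) → Dec (IsPalindrome u)
  palindrome? u = ≡-dec _≟_ u (reverse u)

  SP≤-wrap-singletons : ∀ {a v} → SP≤ 1 (wrap a v) (suc (length v))
  SP≤-wrap-singletons {a} {v} = map [_] (a ∷ v) , cover , ≤-reflexive (length-map [_] (a ∷ v))
    where
    cover : Covers 1 (wrap a v) (map [_] (a ∷ v))
    cover {c ∷ []} c⊆w _ _ with c ≟ a
    ... | yes refl = here refl
    ... | no c≢a   = ∈-map⁺ [_] (to∈ (snoc-≢⁻ {p = []} c≢a c⊆w))

  SP≤-odd-length∸1 : ∀ k {w : List A} → length w ≡ suc (k * 2) → SP≤ (k * 2) w 1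
  SP≤-odd-length∸1 zero    _    = SP≤-empty
  SP≤-odd-length∸1 (suc k) {w} |w|≡ with ends-view w |w|≡
  ... | ends a {v} b |v|≡ with a ≟ b
  ...   | yes refl =
    SP≤-wrap (SP≤-odd-length∸1 k |v|≡) (SP≤-too-long (≤-reflexive (cong suc |v|≡)))
  ...   | no a≢b with palindrome? (a ∷ v)
  ...     | yes pal-av = SP≤-ends-≢ a≢b
    (SP≤-whole-¬palindrome (a≢b ∘ palindromic-shift⇒≡ k |v|≡ pal-av) (length-snoc≡ v b |v|≡))
    (SP≤-whole (cong suc |v|≡))
  ...     | no ¬pal-av = SP≤-ends-≢ a≢b
    (SP≤-whole (length-snoc≡ v b |v|≡))
    (SP≤-whole-¬palindrome ¬pal-av (cong suc |v|≡))

  SP≤-even-length∸1 : ∀ k {w : List A} → length w ≡ 2 + k * 2 → SP≤ (1 + k * 2) w 2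
  SP≤-even-length∸1 zero    |w|≡ = SP≤-mono (≤-reflexive |w|≡) SP≤-singletons
  SP≤-even-length∸1 (suc k) {w} |w|≡ with ends-view w |w|≡
  ... | ends a {v} b |v|≡ with a ≟ b
  ...   | yes refl =
    SP≤-wrap (SP≤-even-length∸1 k |v|≡) (SP≤-too-long (≤-reflexive (cong suc |v|≡)))
  ...   | no a≢b   = SP≤-ends-≢ a≢b (SP≤-whole (length-snoc≡ v b |v|≡)) (SP≤-whole (cong suc |v|≡))

  SP≤-even-length∸2 : ∀ k {w : List A} → length w ≡ 2 + k * 2 → SP≤ (k * 2) w ⌈ 2 + k * 2 /2⌉
  SP≤-even-length∸2 zero    _    = SP≤-empty
  SP≤-even-length∸2 (suc k) {w} |w|≡ with ends-view w |w|≡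
  ... | ends a {v} b |v|≡ with a ≟ b
  ...   | yes refl = SP≤-mono (≤-reflexive (+-comm _ 1))
    (SP≤-wrap (SP≤-even-length∸2 k |v|≡) (SP≤-whole |v|≡))
  ...   | no a≢b   = SP≤-mono (s≤s (s≤s z≤n))
    (SP≤-ends-≢ a≢b (SP≤-odd-length∸1 (suc k) (length-snoc≡ v b |v|≡))
                    (SP≤-odd-length∸1 (suc k) (cong suc |v|≡)))

  SP≤-odd-length∸2-palindrome : ∀ k {w : List A} → length w ≡ 3 + k * 2 → IsPalindrome w →
                                SP≤ (1 + k * 2) w ⌈ 3 + k * 2 /2⌉
  SP≤-odd-length∸2-palindrome zero {w} |w|≡ pal with ends-view w |w|≡
  ... | ends a {v} _ |v|≡ with refl , _ ← palindrome-ends pal =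
    SP≤-mono (≤-reflexive (cong suc |v|≡)) SP≤-wrap-singletons
  SP≤-odd-length∸2-palindrome (suc k) {w} |w|≡ pal with ends-view w |w|≡
  ... | ends a {v} _ |v|≡ with refl , pal-v ← palindrome-ends pal =
    SP≤-mono (≤-reflexive (+-comm _ 1))
      (SP≤-wrap (SP≤-odd-length∸2-palindrome k |v|≡ pal-v) (SP≤-whole |v|≡))

  SP≤-odd-length∸2 : ∀ k {w : List A} → length w ≡ 3 + k * 2 →
                     SP≤ (1 + k * 2) w (4 ⊔ ⌈ 3 + k * 2 /2⌉)
  SP≤-odd-length∸2 zero    |w|≡ = SP≤-mono (≤-trans (≤-reflexive |w|≡) (n≤1+n 3)) SP≤-singletons
  SP≤-odd-length∸2 (suc k) {w} |w|≡ with ends-view w |w|≡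
  ... | ends a {v} b |v|≡ with a ≟ b
  ...   | no a≢b = SP≤-mono (m≤m⊔n 4 ⌈ 5 + k * 2 /2⌉)
    (SP≤-ends-≢ a≢b (SP≤-even-length∸1 (suc k) (length-snoc≡ v b |v|≡))
                    (SP≤-even-length∸1 (suc k) (cong suc |v|≡)))
  ...   | yes refl with palindrome? v
  ...     | yes pal-v = SP≤-mono (≤-trans (≤-reflexive (+-comm _ 1)) (m≤n⊔m 4 ⌈ 5 + k * 2 /2⌉))
    (SP≤-wrap (SP≤-odd-length∸2-palindrome k |v|≡ pal-v) (SP≤-whole |v|≡))
  ...     | no ¬pal-v =
    SP≤-mono (≤-trans (≤-reflexive (+-identityʳ _)) (⊔-monoʳ-≤ 4 (n≤1+n ⌈ 3 + k * 2 /2⌉)))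
    (SP≤-wrap (SP≤-odd-length∸2 k |v|≡) (SP≤-whole-¬palindrome ¬pal-v |v|≡))

  SP≤-sound : ∀ {t w m} → SP≤ t w m → SP _≟_ t w ≤ m
  SP≤-sound {t} {w} (L , cover , |L|≤m) =
    ≤-trans (Unique-⊆⇒length≤ (deduplicate-! (≡-dec _≟_) candidates) ⊆L) |L|≤m
    where
    candidate? = λ (u : List A) → (length u ≟ℕ t) ×-dec ≡-dec _≟_ u (reverse u)
    candidates = filter candidate? (subwords w)
    ⊆L : ∀ {u} → u ∈ deduplicate (≡-dec _≟_) candidates → u ∈ L
    ⊆L u∈ with u∈subwords , |u|≡t , pal ← ∈-filter⁻ candidate? (∈-deduplicate⁻ _ candidates u∈)
      = cover (subwords-⊆ w u∈subwords) |u|≡t pal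

open Counting

even-or-odd : ∀ n → ∃[ k ] (n ≡ k * 2 ⊎ n ≡ suc (k * 2))
even-or-odd zero = 0 , inj₁ refl
even-or-odd (suc n) with even-or-odd n
... | k , inj₁ refl = k , inj₂ refl
... | k , inj₂ refl = suc k , inj₁ refl

proposition4p15 : {A : Set} (_≟A_ : DecidableEquality A) (n : ℕ) → 6 ≤ n →
    (w : List A) → length w ≡ n → SP _≟A_ (n ∸ 2) w ≤ ⌈ n /2⌉
proposition4p15 _≟A_ n 6≤n w |w|≡n with m≤n⇒∃[o]m+o≡n 6≤n
... | m , refl with even-or-odd m
...   | k , inj₁ refl = SP≤-sound _≟A_ (SP≤-even-length∸2 _≟A_ (2 + k) {w} |w|≡n)
...   | k , inj₂ refl = SP≤-sound _≟A_
  (SP≤-mono (≤-reflexive (m≤n⇒m⊔n≡n {n = ⌈ 7 + k * 2 /2⌉} (m≤m+n 4 _)))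
            (SP≤-odd-length∸2 _≟A_ (2 + k) {w} |w|≡n))
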